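{- If $J$ and $G$ are graphs, then for any vertex $w$ of $G$, \[ s(J,G_w^+)=\tilde{r}(J,V(G)\setminus\{w\};x^G,y)\big|_{y_u:= x_{uw}^G}, \] that is, $s(J,G^+_w)$ equals the value of $\tilde{r}(J,V(G)\setminus\{w\};x,y)$ at $x_e=x^G_e$ for all $e$ and $y_u=x^G_{uw}$ for all $u\in V(G)\setminus\{w\}$.
   Context: All graphs are finite and simple; $s(J,G)$ is the number of induced subgraphs of $G$ isomorphic to $J$, and $G^+_w$ is the subgraph of $G$ induced by the vertices adjacent to $w$. For a finite set $S$, $E(K_S)$ is the set of 2-element subsets of $S$, $R_S=\mathbb{R}[x_e \mid e\in E(K_S)]/\langle x_e^2-1\rangle$ (write $x_{ab}$ for $x_{\{a,b\}}$), and $R^\circ_S=R_S[y_v\mid v\in S]/\langle y_v^2-1\mid v\in S\rangle$. $\mathrm{inj}(A,B)$ is the set of injective maps $A\to B$; for an injection $\phi$ and edge $e=uv$, $x_{\phi(e)}$ means $x_{\phi(u)\phi(v)}$. For a graph $J$, $L\subseteq V(J)$ and set $S$, \[ \tilde{k}(J,L,S;x,y) = \sum_{\phi \in \mathrm{inj}(V(J),S)} \prod_{e\in E(J)} x_{\phi(e)} \prod_{u\in L}y_{\phi(u)}\in R^\circ_S. \] For a graph $J$, $K_J$ is the complete graph on $V(J)$, $\mathrm{Aut}(J)$ is the number of automorphisms of $J$, and for $E\subseteq E(K_J)$, $K_J[E]$ is the graph with vertex set $V(J)$ and edge set $E$. Define \[ \tilde{r}(J,S;x,y)= \frac{1}{2^{|E(K_J)|+|V(J)|}\,\mathrm{Aut}(J)}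 \sum_{V\subseteq V(J)}\ \sum_{E\subseteq E(K_J)} (-1)^{| E\setminus E(J)|}\, \tilde{k}(K_J[E],V,S;x,y). \] For a graph $G$ and a 2-subset $e$ of $V(G)$, $x^G_e=1$ if $e\in E(G)$ and $x^G_e=-1$ otherwise. -}

module Defs where

open import Data.Bool using (Bool; true; false; not; _∧_; if_then_else_)
open import Data.Bool.Properties using () renaming (_≟_ to _≟ᵇ_)
open import Data.Nat using (ℕ; zero; suc; _+_; _*_; _^_; _<?_)
open import Data.Fin using (Fin; toℕ) renaming (_≟_ to _≟ᶠ_)
open import Data.Integer using (ℤ; +_; -_) renaming (_*_ to _*ℤ_; _+_ to _+ℤ_)
open import Data.Rational using (ℚ; _/_; 0ℚ)
open import Data.List using (List; []; _∷_; map; concatMap; allFin; filterᵇ; length; cartesianProduct; foldr; zip)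
open import Data.Bool.ListAction using (all; any)
open import Data.Vec using (Vec; []; _∷_; lookup; toList)
open import Data.Product using (_×_; _,_; proj₁; proj₂)
open import Relation.Nullary.Decidable using (⌊_⌋)
open import Relation.Binary.PropositionalEquality using (_≡_)

record Graph (n : ℕ) : Set where
  field
    adj   : Fin n → Fin n → Bool
    sym   : ∀ i j → adj i j ≡ adj j i
    irrefl : ∀ i → adj i i ≡ false
open Graph public

_==ᶠ_ : ∀ {n} → Fin n → Fin n → Bool
a ==ᶠ b = ⌊ a ≟ᶠ b ⌋

_==ᵇ_ : Bool → Bool → Bool
a ==ᵇ b = ⌊ a ≟ᵇ b ⌋

-- All vectors of length m with entries from a list (enumerates all maps Fin m → A).
allVec : ∀ {A : Set} → List A → (m : ℕ) → List (Vec A m)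
allVec xs zero = [] ∷ []
allVec xs (suc m) = concatMap (λ a → map (a ∷_) (allVec xs m)) xs

-- E(K_m): the 2-element subsets {i,j} of Fin m, listed as pairs (i , j) with i < j.
pairs : (m : ℕ) → List (Fin m × Fin m)
pairs m = filterᵇ (λ p → ⌊ toℕ (proj₁ p) <? toℕ (proj₂ p) ⌋)
                  (cartesianProduct (allFin m) (allFin m))

allSubsets : (m : ℕ) → List (Vec Bool m)
allSubsets m = allVec (true ∷ false ∷ []) m

injB : ∀ {m n} → Vec (Fin n) m → Bool
injB {m} v = all (λ p → not (lookup v (proj₁ p) ==ᶠ lookup v (proj₂ p))) (pairs m)

surjB : ∀ {m n} → Vec (Fin n) m → Bool
surjB {m} {n} v = all (λ j → any (λ i → lookup v i ==ᶠ j) (allFin m)) (allFin n)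

isIsoB : ∀ {m k} → Graph m → Graph k → Vec (Fin k) m → Bool
isIsoB {m} J K φ = injB φ ∧ surjB φ ∧
  all (λ i → all (λ j → adj J i j ==ᵇ adj K (lookup φ i) (lookup φ j)) (allFin m)) (allFin m)

isomorphicB : ∀ {m k} → Graph m → Graph k → Bool
isomorphicB {m} {k} J K = any (isIsoB J K) (allVec (allFin k) m)

autCount : ∀ {m} → Graph m → ℕ
autCount {m} J = length (filterᵇ (isIsoB J J) (allVec (allFin m) m))

-- Induced subgraph of G on the (duplicate-free) vertex list L, as a graph on Fin (length L).
inducedOn : ∀ {n} → Graph n → (L : List (Fin n)) → Graph (length L)
inducedOn G L = record
  { adj = λ i j → adj G (Data.List.lookup L i) (Data.List.lookup L j)
  ; sym = λ i j → sym G (Data.List.lookup L i) (Data.List.lookup L j)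
  ; irrefl = λ i → irrefl G (Data.List.lookup L i) }

members : ∀ {n} → Vec Bool n → List (Fin n)
members {n} U = filterᵇ (lookup U) (allFin n)

sCount : ∀ {m k} → Graph m → Graph k → ℕ
sCount {m} {k} J H = length (filterᵇ (λ U → isomorphicB J (inducedOn H (members U))) (allSubsets k))

nbhdGraph : ∀ {n} → (G : Graph n) → (w : Fin n) → Graph (length (filterᵇ (adj G w) (allFin n)))
nbhdGraph {n} G w = inducedOn G (filterᵇ (adj G w) (allFin n))

sumℤ : List ℤ → ℤ
sumℤ = foldr _+ℤ_ (+ 0)

prodℤ : List ℤ → ℤ
prodℤ = foldr _*ℤ_ (+ 1)

xG : ∀ {n} → Graph n → Fin n → Fin n → ℤ
xG G a b = if adj G a b then + 1 else - (+ 1)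

injAvoiding : (m : ℕ) → ∀ {n} → Fin n → List (Vec (Fin n) m)
injAvoiding m {n} w = filterᵇ (λ φ → injB φ ∧ all (λ i → not (lookup φ i ==ᶠ w)) (allFin m))
                              (allVec (allFin n) m)

selectedPairs : ∀ {m} → Vec Bool (length (pairs m)) → List (Fin m × Fin m)
selectedPairs {m} E = map proj₁ (filterᵇ proj₂ (zip (pairs m) (toList E)))

-- k̃(K_J[E], V, V(G)∖{w}; x, y) evaluated at x_e = x^G_e and y_u = x^G_{uw}.
kTildeEval : ∀ {m n} → List (Fin m × Fin m) → Vec Bool m → Graph n → Fin n → ℤ
kTildeEval {m} E V G w =
  sumℤ (map (λ φ → prodℤ (map (λ e → xG G (lookup φ (proj₁ e)) (lookup φ (proj₂ e))) E)
                   *ℤ prodℤ (map (λ u → xG G (lookup φ u) w) (members V)))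
            (injAvoiding m w))

signℤ : ℕ → ℤ
signℤ zero = + 1
signℤ (suc k) = - signℤ k

-- integer divided by a natural number (the denominator below is always nonzero,
-- since Aut(J) ≥ 1; the zero case is only for totality)
divℚ : ℤ → ℕ → ℚ
divℚ z zero = 0ℚ
divℚ z (suc d) = z / suc d

-- r̃(J, V(G)∖{w}; x, y) evaluated at x_e = x^G_e, y_u = x^G_{uw}.
rTildeEval : ∀ {m n} → Graph m → Graph n → Fin n → ℚ
rTildeEval {m} J G w =
  divℚ (sumℤ (map (λ V → sumℤ (map (λ E →
           signℤ (length (filterᵇ (λ e → not (adj J (proj₁ e) (proj₂ e))) (selectedPairs E)))
           *ℤ kTildeEval (selectedPairs E) V G w)
         (allSubsets (length (pairs m)))))
       (allSubsets m)))
       (2 ^ (length (pairs m) + m) * autCount J)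

-- At the evaluation point the numerator of r̃ is a sum over V ⊆ V(J), E ⊆ E(K_J) and injections
-- φ : V(J) → V(G) ∖ {w}.  Exchanging the sums, each φ contributes
--   (∑_E (-1)^{|E ∖ E(J)|} ∏_{e ∈ E} x^G_{φ(e)}) · (∑_V ∏_{u ∈ V} x^G_{φ(u)w})
--     = ∏_{e ∈ E(K_J)} (1 ± x^G_{φ(e)}) · ∏_{u ∈ V(J)} (1 + x^G_{φ(u)w}),
-- which is 2^{|E(K_J)|+|V(J)|} when φ is an induced embedding of J into G with image in N(w), and 0
-- otherwise.  These embeddings are the induced embeddings of J into G⁺_w; grouped by their image U,
-- each U with G⁺_w[U] ≅ J carries exactly Aut(J) of them.  So the numerator is
-- 2^{|E(K_J)|+|V(J)|} · Aut(J) · s(J, G⁺_w), and dividing by the denominator of r̃ gives s(J, G⁺_w).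
module Submission where

open import Defs hiding (sym)
open import Algebra.Bundles using (CommutativeSemiring)
open import Data.Bool using (Bool; true; false; not; _∧_; if_then_else_; T; T?)
open import Data.Bool.Properties using (T-not-≡)
open import Data.Nat using (ℕ; zero; suc; _<_; _<?_)
open import Data.Fin using (Fin; zero; suc; toℕ)
open import Data.Fin.Properties using (<-cmp; suc-injective)
open import Data.List using (List; []; _∷_; length; map; foldr; _++_; concatMap; filterᵇ; allFin; tabulate; cartesianProduct)
open import Data.List.Properties using (map-∘; map-tabulate; map-cong)
open import Data.Vec.Properties using (lookup-map; lookup∘tabulate)
open import Data.List.Membership.Propositional using (_∈_)
open import Data.List.Membership.Propositional.Properties
  using (∈-allFin; ∈-filter⁺; ∈-filter⁻; ∈-cartesianProduct⁺; ∈-concatMap⁺; ∈-map⁺; ∈-length)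
open import Data.List.Relation.Unary.Any using (here; there; satisfied)
import Data.List.Relation.Unary.All as All
import Data.List.Relation.Unary.Any.Properties as Any
open import Data.List.Relation.Unary.All.Properties using (all⁺; all⁻)
open import Data.Bool.ListAction using (all; any)
open import Data.Vec using (Vec; []; _∷_; lookup)
open import Data.Product using (_×_; _,_; proj₁; proj₂; ∃-syntax)
open import Data.Unit using (tt)
open import Data.Empty using (⊥; ⊥-elim)
open import Function using (_∘_; id; Equivalence)
open import Function.Definitions using (Injective)
open import Relation.Binary.Definitions using (tri<; tri≈; tri>)
open import Relation.Nullary.Decidable using (⌊_⌋; toWitness; fromWitness; fromWitnessFalse)
open import Relation.Binary.PropositionalEquality
import Relation.Binary.PropositionalEquality as ≡
import Data.List as List
import Data.Nat as ℕ
import Data.Nat.Properties as ℕₚ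
import Data.Integer as ℤ
import Data.Integer.Properties as ℤₚ
import Data.Rational.Properties as ℚₚ
open import Data.Integer using (+_)
open import Data.Rational using (_/_)
open import Data.Rational.Unnormalised using (mkℚᵘ; *≡*)
import Data.Vec as Vec

module FiniteSums {c ℓ} (R : CommutativeSemiring c ℓ) where

  open CommutativeSemiring R hiding (zero)
    renaming (refl to ≈-refl; sym to ≈-sym; trans to ≈-trans)
  open import Algebra.Properties.CommutativeSemigroup +-commutativeSemigroup using (interchange)

  ∑ : {A : Set} → List A → (A → Carrier) → Carrier
  ∑ l f = foldr _+_ 0# (map f l)

  module _ {A : Set} where

    ∑-cong : ∀ (l : List A) {f g : A → Carrier} → (∀ x → f x ≈ g x) → ∑ l f ≈ ∑ l g
    ∑-cong []      f≈g = ≈-refl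
    ∑-cong (x ∷ l) f≈g = +-cong (f≈g x) (∑-cong l f≈g)

    ∑-++ : ∀ (l₁ l₂ : List A) (f : A → Carrier) → ∑ (l₁ ++ l₂) f ≈ ∑ l₁ f + ∑ l₂ f
    ∑-++ []       l₂ f = ≈-sym (+-identityˡ _)
    ∑-++ (x ∷ l₁) l₂ f = ≈-trans (+-congˡ (∑-++ l₁ l₂ f)) (≈-sym (+-assoc (f x) _ _))

    ∑-+ : ∀ (l : List A) (f g : A → Carrier) → ∑ l (λ x → f x + g x) ≈ ∑ l f + ∑ l g
    ∑-+ []      f g = ≈-sym (+-identityˡ 0#)
    ∑-+ (x ∷ l) f g = ≈-trans (+-congˡ (∑-+ l f g)) (interchange (f x) (g x) (∑ l f) (∑ l g))

    ∑-0 : ∀ (l : List A) → ∑ l (λ _ → 0#) ≈ 0#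
    ∑-0 []      = ≈-refl
    ∑-0 (x ∷ l) = ≈-trans (+-identityˡ _) (∑-0 l)

    ∑-*ˡ : ∀ (l : List A) (a : Carrier) (f : A → Carrier) → a * ∑ l f ≈ ∑ l (λ x → a * f x)
    ∑-*ˡ []      a f = zeroʳ a
    ∑-*ˡ (x ∷ l) a f = ≈-trans (distribˡ a (f x) (∑ l f)) (+-congˡ (∑-*ˡ l a f))

    ∑-*ʳ : ∀ (l : List A) (a : Carrier) (f : A → Carrier) → ∑ l f * a ≈ ∑ l (λ x → f x * a)
    ∑-*ʳ l a f = ≈-trans (*-comm (∑ l f) a) (≈-trans (∑-*ˡ l a f) (∑-cong l (λ x → *-comm a (f x))))

    ∑-filter : ∀ (p : A → Bool) (l : List A) (f : A → Carrier) →
               ∑ (filterᵇ p l) f ≈ ∑ l (λ x → if p x then f x else 0#)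
    ∑-filter p []      f = ≈-refl
    ∑-filter p (x ∷ l) f with p x
    ... | true  = +-congˡ (∑-filter p l f)
    ... | false = ≈-trans (∑-filter p l f) (≈-sym (+-identityˡ _))

  module _ {A B : Set} where

    ∑-map : ∀ (g : A → B) (l : List A) (f : B → Carrier) → ∑ (map g l) f ≡.≡ ∑ l (f ∘ g)
    ∑-map g l f = ≡.cong (foldr _+_ 0#) (≡.sym (map-∘ l))

    ∑-concatMap : ∀ (h : A → List B) (l : List A) (f : B → Carrier) →
                  ∑ (concatMap h l) f ≈ ∑ l (λ x → ∑ (h x) f)
    ∑-concatMap h []      f = ≈-refl
    ∑-concatMap h (x ∷ l) f = ≈-trans (∑-++ (h x) (concatMap h l) f) (+-congˡ (∑-concatMap h l f))

    ∑-swap : ∀ (l₁ : List A) (l₂ : List B) (f : A → B → Carrier) →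
             ∑ l₁ (λ a → ∑ l₂ (f a)) ≈ ∑ l₂ (λ b → ∑ l₁ (λ a → f a b))
    ∑-swap []       l₂ f = ≈-sym (∑-0 l₂)
    ∑-swap (x ∷ l₁) l₂ f = ≈-trans (+-congˡ (∑-swap l₁ l₂ f)) (≈-sym (∑-+ l₂ (f x) _))

  ∑-allSubsets-suc : ∀ k (F : Vec Bool (suc k) → Carrier) →
    ∑ (allSubsets (suc k)) F ≈ ∑ (allSubsets k) (F ∘ (true ∷_)) + ∑ (allSubsets k) (F ∘ (false ∷_))
  ∑-allSubsets-suc k F = ≈-trans (∑-concatMap (λ a → map (a ∷_) (allSubsets k)) (true ∷ false ∷ []) F)
    (+-cong (reflexive (∑-map (true ∷_) (allSubsets k) F))
            (≈-trans (+-identityʳ _) (reflexive (∑-map (false ∷_) (allSubsets k) F))))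

  ∑-allFin-suc : ∀ n (h : Fin (suc n) → Carrier) → ∑ (allFin (suc n)) h ≡.≡ h zero + ∑ (allFin n) (h ∘ suc)
  ∑-allFin-suc n h = ≡.cong (λ l → h zero + foldr _+_ 0# l)
    (≡.trans (map-tabulate suc h) (≡.sym (map-tabulate id (h ∘ suc))))

  ∑-lookup : ∀ {A : Set} (l : List A) (h : A → Carrier) → ∑ (allFin (length l)) (h ∘ List.lookup l) ≡.≡ ∑ l h
  ∑-lookup []      h = ≡.refl
  ∑-lookup (x ∷ l) h = ≡.trans (∑-allFin-suc (length l) (h ∘ List.lookup (x ∷ l)))
                                (≡.cong (λ t → h x + t) (∑-lookup l h))

module ℕΣ = FiniteSums ℕₚ.+-*-commutativeSemiring

T-ext : ∀ {a b : Bool} → (T a → T b) → (T b → T a) → a ≡ b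
T-ext {true}  {true}  _ _ = refl
T-ext {true}  {false} f _ = ⊥-elim (f tt)
T-ext {false} {true}  _ g = ⊥-elim (g tt)
T-ext {false} {false} _ _ = refl

split∧ : ∀ a {b} → T (a ∧ b) → T a × T b
split∧ true t = tt , t

join∧ : ∀ {a b} → T a → T b → T (a ∧ b)
join∧ {true} _ t = t

==ᶠ-sound : ∀ {n} {x y : Fin n} → T (x ==ᶠ y) → x ≡ y
==ᶠ-sound = toWitness

==ᶠ-complete : ∀ {n} {x y : Fin n} → x ≡ y → T (x ==ᶠ y)
==ᶠ-complete = fromWitness

==ᶠ-false : ∀ {n} {x y : Fin n} → x ≢ y → (x ==ᶠ y) ≡ false
==ᶠ-false x≢y = Equivalence.to T-not-≡ (fromWitnessFalse x≢y)

==ᵇ-sound : ∀ {a b : Bool} → T (a ==ᵇ b) → a ≡ b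
==ᵇ-sound = toWitness

==ᵇ-complete : ∀ {a b : Bool} → a ≡ b → T (a ==ᵇ b)
==ᵇ-complete = fromWitness

==ᶠ-suc : ∀ {n} (x y : Fin n) → (suc x ==ᶠ suc y) ≡ (x ==ᶠ y)
==ᶠ-suc x y = T-ext (==ᶠ-complete ∘ suc-injective ∘ ==ᶠ-sound) (==ᶠ-complete ∘ cong suc ∘ ==ᶠ-sound)

==ᶠ-sym : ∀ {n} (x y : Fin n) → (x ==ᶠ y) ≡ (y ==ᶠ x)
==ᶠ-sym x y = T-ext (==ᶠ-complete ∘ sym ∘ ==ᶠ-sound) (==ᶠ-complete ∘ sym ∘ ==ᶠ-sound)

==ᶠ-injective : ∀ {a n} {g : Fin a → Fin n} → Injective _≡_ _≡_ g → ∀ x y → (g x ==ᶠ g y) ≡ (x ==ᶠ y)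
==ᶠ-injective inj x y = T-ext (==ᶠ-complete ∘ inj ∘ ==ᶠ-sound) (==ᶠ-complete ∘ cong _ ∘ ==ᶠ-sound)

module _ {A : Set} {p : A → Bool} where

  all-sound : ∀ l {x} → T (all p l) → x ∈ l → T (p x)
  all-sound l t = All.lookup (all⁺ p l t)

  all-complete : ∀ l → (∀ {x} → x ∈ l → T (p x)) → T (all p l)
  all-complete l h = all⁻ p (All.tabulate h)

module _ {n : ℕ} {p : Fin n → Bool} where

  allFin-sound : T (all p (allFin n)) → ∀ i → T (p i)
  allFin-sound t i = all-sound (allFin n) t (∈-allFin i)

  allFin-complete : (∀ i → T (p i)) → T (all p (allFin n))
  allFin-complete h = all-complete (allFin n) (λ {i} _ → h i)

  anyFin-sound : T (any p (allFin n)) → ∃[ i ] T (p i)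
  anyFin-sound t = Any.tabulate⁻ (Any.any⁻ p (allFin n) t)

  anyFin-complete : ∀ i → T (p i) → T (any p (allFin n))
  anyFin-complete i t = Any.any⁺ p (Any.tabulate⁺ i t)

all-allFin-suc : ∀ n (q : Fin (suc n) → Bool) → all q (allFin (suc n)) ≡ q zero ∧ all (q ∘ suc) (allFin n)
all-allFin-suc n q = cong (λ l → q zero ∧ foldr _∧_ true l)
  (trans (map-tabulate suc q) (sym (map-tabulate id (q ∘ suc))))

module _ {m : ℕ} {p : Fin m × Fin m → Bool} where

  allPairs-sound : T (all p (pairs m)) → ∀ a b → toℕ a < toℕ b → T (p (a , b))
  allPairs-sound t a b a<b =
    all-sound (pairs m) t (∈-filter⁺ _ (∈-cartesianProduct⁺ (∈-allFin a) (∈-allFin b)) (fromWitness a<b))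

  allPairs-complete : (∀ a b → toℕ a < toℕ b → T (p (a , b))) → T (all p (pairs m))
  allPairs-complete h = all-complete (pairs m) λ {(a , b)} ab∈ → h a b (toWitness (proj₂
    (∈-filter⁻ (λ e → T? ⌊ toℕ (proj₁ e) <? toℕ (proj₂ e) ⌋)
               {xs = cartesianProduct (allFin m) (allFin m)} ab∈)))

Injectiveᵛ : ∀ {m k} → Vec (Fin k) m → Set
Injectiveᵛ φ = Injective _≡_ _≡_ (lookup φ)

Surjectiveᵛ : ∀ {m k} → Vec (Fin k) m → Set
Surjectiveᵛ {m} φ = ∀ j → ∃[ i ] lookup φ i ≡ j

Preserves : ∀ {m k} → Graph m → Graph k → Vec (Fin k) m → Set
Preserves J K φ = ∀ i j → adj J i j ≡ adj K (lookup φ i) (lookup φ j)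

T-not-¬ : ∀ {b} → T (not b) → T b → ⊥
T-not-¬ {true}  () _
T-not-¬ {false} _ ()

injB-sound : ∀ {m k} (φ : Vec (Fin k) m) → T (injB φ) → Injectiveᵛ φ
injB-sound φ t {i} {j} φi≡φj with <-cmp i j
... | tri< i<j _ _ = ⊥-elim (T-not-¬ (allPairs-sound t i j i<j) (==ᶠ-complete φi≡φj))
... | tri≈ _ i≡j _ = i≡j
... | tri> _ _ j<i = ⊥-elim (T-not-¬ (allPairs-sound t j i j<i) (==ᶠ-complete (sym φi≡φj)))

injB-complete : ∀ {m k} (φ : Vec (Fin k) m) → Injectiveᵛ φ → T (injB φ)
injB-complete φ inj = allPairs-complete λ a b a<b →
  Equivalence.from T-not-≡ (==ᶠ-false λ φa≡φb → ℕₚ.<-irrefl (cong toℕ (inj φa≡φb)) a<b)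

surjB-sound : ∀ {m k} (φ : Vec (Fin k) m) → T (surjB φ) → Surjectiveᵛ φ
surjB-sound φ t j = let i , φi==j = anyFin-sound (allFin-sound t j) in i , ==ᶠ-sound φi==j

surjB-complete : ∀ {m k} (φ : Vec (Fin k) m) → Surjectiveᵛ φ → T (surjB φ)
surjB-complete φ onto = allFin-complete λ j →
  let i , φi≡j = onto j in anyFin-complete i (==ᶠ-complete φi≡j)

-- Agreement of adjacency checked on the pairs i < j only; enough since graphs are symmetric and loopless.
sameAdjᵇ : ∀ {m k} → Graph m → Graph k → Vec (Fin k) m → Bool
sameAdjᵇ {m} J K φ =
  all (λ e → adj J (proj₁ e) (proj₂ e) ==ᵇ adj K (lookup φ (proj₁ e)) (lookup φ (proj₂ e))) (pairs m)

sameAdj-sound : ∀ {m k} (J : Graph m) (K : Graph k) φ → T (sameAdjᵇ J K φ) → Preserves J K φ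
sameAdj-sound J K φ t i j with <-cmp i j
... | tri< i<j _ _ = ==ᵇ-sound (allPairs-sound t i j i<j)
... | tri≈ _ refl _ = trans (irrefl J i) (sym (irrefl K (lookup φ i)))
... | tri> _ _ j<i = trans (Graph.sym J i j) (trans (==ᵇ-sound (allPairs-sound t j i j<i)) (Graph.sym K _ _))

sameAdj-complete : ∀ {m k} (J : Graph m) (K : Graph k) φ → Preserves J K φ → T (sameAdjᵇ J K φ)
sameAdj-complete J K φ pres = allPairs-complete λ a b _ → ==ᵇ-complete (pres a b)

record IsIso {m k} (J : Graph m) (K : Graph k) (φ : Vec (Fin k) m) : Set where
  field
    injective  : Injectiveᵛ φ
    surjective : Surjectiveᵛ φ
    preserves  : Preserves J K φ

isIso-sound : ∀ {m k} (J : Graph m) (K : Graph k) φ → T (isIsoB J K φ) → IsIso J K φ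
isIso-sound J K φ t = record
  { injective  = injB-sound φ tinj
  ; surjective = surjB-sound φ tsurj
  ; preserves  = λ i j → ==ᵇ-sound (allFin-sound (allFin-sound tadj i) j) }
  where
  tinj  = proj₁ (split∧ (injB φ) t)
  tsurj = proj₁ (split∧ (surjB φ) (proj₂ (split∧ (injB φ) t)))
  tadj  = proj₂ (split∧ (surjB φ) (proj₂ (split∧ (injB φ) t)))

isIso-complete : ∀ {m k} (J : Graph m) (K : Graph k) φ → IsIso J K φ → T (isIsoB J K φ)
isIso-complete J K φ iso = join∧ (injB-complete φ injective) (join∧ (surjB-complete φ surjective)
  (allFin-complete λ i → allFin-complete λ j → ==ᵇ-complete (preserves i j)))
  where open IsIso iso

embᵇ : ∀ {m k} → Graph m → Graph k → Vec (Fin k) m → Bool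
embᵇ J K φ = injB φ ∧ sameAdjᵇ J K φ

iso≡emb∧surj : ∀ {m k} (J : Graph m) (K : Graph k) φ → isIsoB J K φ ≡ embᵇ J K φ ∧ surjB φ
iso≡emb∧surj J K φ = T-ext
  (λ t → let open IsIso (isIso-sound J K φ t) in
     join∧ (join∧ (injB-complete φ injective) (sameAdj-complete J K φ preserves)) (surjB-complete φ surjective))
  (λ t → let e , s = split∧ (embᵇ J K φ) t ; i , a = split∧ (injB φ) e in
     isIso-complete J K φ record
       { injective = injB-sound φ i ; surjective = surjB-sound φ s ; preserves = sameAdj-sound J K φ a })

compose-iso : ∀ {m k} (J : Graph m) (K : Graph k) {χ₀ : Vec (Fin k) m} → IsIso J K χ₀ →
              ∀ (σ : Vec (Fin m) m) → isIsoB J K (Vec.map (lookup χ₀) σ) ≡ isIsoB J J σ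
compose-iso J K {χ₀} iso₀ σ = T-ext to from
  where
  open IsIso iso₀ renaming (injective to inj₀; surjective to surj₀; preserves to pres₀)
  g = lookup χ₀
  χ = Vec.map g σ
  χ-at : ∀ i → lookup χ i ≡ g (lookup σ i)
  χ-at i = lookup-map i g σ
  to : T (isIsoB J K χ) → T (isIsoB J J σ)
  to t = isIso-complete J J σ record
    { injective  = λ {i} {j} σi≡σj → injective (trans (χ-at i) (trans (cong g σi≡σj) (sym (χ-at j))))
    ; surjective = λ x → let i , χi≡gx = surjective (g x) in i , inj₀ (trans (sym (χ-at i)) χi≡gx)
    ; preserves  = λ i j → trans (preserves i j)
        (trans (cong₂ (adj K) (χ-at i) (χ-at j)) (sym (pres₀ (lookup σ i) (lookup σ j)))) }
    where open IsIso (isIso-sound J K χ t)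
  from : T (isIsoB J J σ) → T (isIsoB J K χ)
  from t = isIso-complete J K χ record
    { injective  = λ {i} {j} χi≡χj → injective (inj₀ (trans (sym (χ-at i)) (trans χi≡χj (χ-at j))))
    ; surjective = λ y → let x , gx≡y = surj₀ y ; i , σi≡x = surjective x in
                         i , trans (χ-at i) (trans (cong g σi≡x) gx≡y)
    ; preserves  = λ i j → trans (preserves i j)
        (trans (pres₀ (lookup σ i) (lookup σ j)) (sym (cong₂ (adj K) (χ-at i) (χ-at j)))) }
    where open IsIso (isIso-sound J J σ t)

emb-induced : ∀ {m n} (J : Graph m) (G : Graph n) (L : List (Fin n)) → Injective _≡_ _≡_ (List.lookup L) →
              ∀ (ψ : Vec (Fin (length L)) m) → embᵇ J G (Vec.map (List.lookup L) ψ) ≡ embᵇ J (inducedOn G L) ψ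
emb-induced {m} J G L inj ψ = cong₂ _∧_
  (cong (foldr _∧_ true) (map-cong (λ e → cong not (trans (cong₂ _==ᶠ_ (at (proj₁ e)) (at (proj₂ e)))
                                                            (==ᶠ-injective inj _ _))) (pairs m)))
  (cong (foldr _∧_ true) (map-cong (λ e → cong (adj J (proj₁ e) (proj₂ e) ==ᵇ_)
                                              (cong₂ (adj G) (at (proj₁ e)) (at (proj₂ e)))) (pairs m)))
  where
  at : ∀ i → lookup (Vec.map (List.lookup L) ψ) i ≡ List.lookup L (lookup ψ i)
  at i = lookup-map i (List.lookup L) ψ

∈-allVec : ∀ {n m} (v : Vec (Fin n) m) → v ∈ allVec (allFin n) m
∈-allVec []      = here refl
∈-allVec (x ∷ v) = ∈-concatMap⁺ (λ a → List.map (a ∷_) _) (Any.tabulate⁺ x (∈-map⁺ (x ∷_) (∈-allVec v)))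

-- The identity is an automorphism, so Aut(J) ≥ 1.
autCount-pos : ∀ {m} (J : Graph m) → 0 < autCount J
autCount-pos {m} J = ∈-length (∈-filter⁺ (T? ∘ isIsoB J J) (∈-allVec identity) (isIso-complete J J identity record
  { injective  = λ {i} {j} e → trans (sym (at i)) (trans e (at j))
  ; surjective = λ j → j , at j
  ; preserves  = λ i j → sym (cong₂ (adj J) (at i) (at j)) }))
  where
  identity : Vec (Fin m) m
  identity = Vec.tabulate id
  at : ∀ i → lookup identity i ≡ i
  at = lookup∘tabulate id

module Counting where

  open import Data.Nat using (_+_; _*_; _≤_; z≤n; s≤s)
  open ℕₚ using (+-identityʳ; +-comm; *-identityʳ; *-identityˡ; *-comm; *-assoc; *-zeroʳ;
                m≤m+n; m≤n+m; +-monoʳ-≤; ≤-trans)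
  open ℕΣ
  open import Data.Fin.Properties using (_≟_)
  open import Data.Vec.Properties using (tabulate-cong; tabulate∘lookup)
  open import Relation.Nullary using (¬_; yes; no)
  open ≡-Reasoning

  ⟦_⟧ : Bool → ℕ
  ⟦ true  ⟧ = 1
  ⟦ false ⟧ = 0

  ⟦∧⟧ : ∀ a b → ⟦ a ∧ b ⟧ ≡ ⟦ a ⟧ * ⟦ b ⟧
  ⟦∧⟧ true  b = sym (+-identityʳ ⟦ b ⟧)
  ⟦∧⟧ false b = refl

  length-filter : ∀ {A : Set} (p : A → Bool) (l : List A) → length (filterᵇ p l) ≡ ∑ l (⟦_⟧ ∘ p)
  length-filter p []      = refl
  length-filter p (x ∷ l) with p x
  ... | true  = cong suc (length-filter p l)
  ... | false = length-filter p l

  ∑⟦⟧>0⇒any : ∀ {A : Set} (q : A → Bool) (l : List A) → 0 < ∑ l (⟦_⟧ ∘ q) → T (any q l)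
  ∑⟦⟧>0⇒any q (x ∷ l) pos with q x
  ... | true  = tt
  ... | false = ∑⟦⟧>0⇒any q l pos

  ¬any⇒∑⟦⟧≡0 : ∀ {A : Set} (q : A → Bool) (l : List A) → any q l ≡ false → ∑ l (⟦_⟧ ∘ q) ≡ 0
  ¬any⇒∑⟦⟧≡0 q []      _ = refl
  ¬any⇒∑⟦⟧≡0 q (x ∷ l) e with q x
  ... | false = ¬any⇒∑⟦⟧≡0 q l e

  ∑-point : ∀ n (z : Fin n) (G : Fin n → ℕ) → ∑ (allFin n) (λ x → ⟦ z ==ᶠ x ⟧ * G x) ≡ G z
  ∑-point (suc n) zero G = begin
      ∑ (allFin (suc n)) (λ x → ⟦ zero ==ᶠ x ⟧ * G x)
    ≡⟨ ∑-allFin-suc n (λ x → ⟦ zero ==ᶠ x ⟧ * G x) ⟩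
      (G zero + 0) + ∑ (allFin n) (λ _ → 0)
    ≡⟨ cong₂ _+_ (+-identityʳ (G zero)) (∑-0 (allFin n)) ⟩
      G zero + 0
    ≡⟨ +-identityʳ (G zero) ⟩
      G zero ∎
  ∑-point (suc n) (suc z) G = begin
      ∑ (allFin (suc n)) (λ x → ⟦ suc z ==ᶠ x ⟧ * G x)
    ≡⟨ ∑-allFin-suc n (λ x → ⟦ suc z ==ᶠ x ⟧ * G x) ⟩
      ∑ (allFin n) (λ x → ⟦ suc z ==ᶠ suc x ⟧ * G (suc x))
    ≡⟨ ∑-cong (allFin n) (λ x → cong (λ b → ⟦ b ⟧ * G (suc x)) (==ᶠ-suc z x)) ⟩
      ∑ (allFin n) (λ x → ⟦ z ==ᶠ x ⟧ * G (suc x))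
    ≡⟨ ∑-point n z (G ∘ suc) ⟩
      G (suc z) ∎

  fibre : ∀ {a n} → (Fin a → Fin n) → Fin n → ℕ
  fibre {a} g x = ∑ (allFin a) (λ y → ⟦ g y ==ᶠ x ⟧)

  ∑-fibres : ∀ {a n} (g : Fin a → Fin n) (G : Fin n → ℕ) →
             ∑ (allFin n) (λ x → fibre g x * G x) ≡ ∑ (allFin a) (G ∘ g)
  ∑-fibres {a} {n} g G = begin
      ∑ (allFin n) (λ x → fibre g x * G x)
    ≡⟨ ∑-cong (allFin n) (λ x → ∑-*ʳ (allFin a) (G x) (λ y → ⟦ g y ==ᶠ x ⟧)) ⟩
      ∑ (allFin n) (λ x → ∑ (allFin a) (λ y → ⟦ g y ==ᶠ x ⟧ * G x))
    ≡⟨ ∑-swap (allFin n) (allFin a) (λ x y → ⟦ g y ==ᶠ x ⟧ * G x) ⟩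
      ∑ (allFin a) (λ y → ∑ (allFin n) (λ x → ⟦ g y ==ᶠ x ⟧ * G x))
    ≡⟨ ∑-cong (allFin a) (λ y → ∑-point n (g y) G) ⟩
      ∑ (allFin a) (G ∘ g) ∎

  -- The number of ψ : Fin m → Fin a with g ∘ ψ = φ.
  weight : ∀ {a n m} → (Fin a → Fin n) → Vec (Fin n) m → ℕ
  weight g []      = 1
  weight g (x ∷ φ) = fibre g x * weight g φ

  reindex : ∀ {a n} m (g : Fin a → Fin n) (F : Vec (Fin n) m → ℕ) →
            ∑ (allVec (allFin n) m) (λ φ → weight g φ * F φ) ≡ ∑ (allVec (allFin a) m) (F ∘ Vec.map g)
  reindex zero    g F = cong (_+ 0) (+-identityʳ (F []))
  reindex {a} {n} (suc m) g F = begin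
      ∑ (allVec (allFin n) (suc m)) (λ φ → weight g φ * F φ)
    ≡⟨ ∑-concatMap (λ x → map (x ∷_) Φ) (allFin n) _ ⟩
      ∑ (allFin n) (λ x → ∑ (map (x ∷_) Φ) (λ φ → weight g φ * F φ))
    ≡⟨ ∑-cong (allFin n) (λ x → trans (∑-map (x ∷_) Φ _) (factor x)) ⟩
      ∑ (allFin n) (λ x → fibre g x * ∑ Φ (λ φ → weight g φ * F (x ∷ φ)))
    ≡⟨ ∑-cong (allFin n) (λ x → cong (fibre g x *_) (reindex m g (F ∘ (x ∷_)))) ⟩
      ∑ (allFin n) (λ x → fibre g x * ∑ Ψ (λ ψ → F (x ∷ Vec.map g ψ)))
    ≡⟨ ∑-fibres g (λ x → ∑ Ψ (λ ψ → F (x ∷ Vec.map g ψ))) ⟩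
      ∑ (allFin a) (λ y → ∑ Ψ (λ ψ → F (g y ∷ Vec.map g ψ)))
    ≡⟨ ∑-cong (allFin a) (λ y → sym (∑-map (y ∷_) Ψ (F ∘ Vec.map g))) ⟩
      ∑ (allFin a) (λ y → ∑ (map (y ∷_) Ψ) (F ∘ Vec.map g))
    ≡⟨ sym (∑-concatMap (λ y → map (y ∷_) Ψ) (allFin a) (F ∘ Vec.map g)) ⟩
      ∑ (allVec (allFin a) (suc m)) (F ∘ Vec.map g) ∎
    where
    Φ = allVec (allFin n) m
    Ψ = allVec (allFin a) m
    factor : ∀ x → ∑ Φ (λ φ → (fibre g x * weight g φ) * F (x ∷ φ))
                 ≡ fibre g x * ∑ Φ (λ φ → weight g φ * F (x ∷ φ))
    factor x = trans (∑-cong Φ (λ φ → *-assoc (fibre g x) (weight g φ) (F (x ∷ φ))))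
                     (sym (∑-*ˡ Φ (fibre g x) (λ φ → weight g φ * F (x ∷ φ))))

  T⇒⟦⟧≡1 : ∀ {b} → T b → ⟦ b ⟧ ≡ 1
  T⇒⟦⟧≡1 {true} _ = refl

  ⟦⟧≥1⇒T : ∀ b → 1 ≤ ⟦ b ⟧ → T b
  ⟦⟧≥1⇒T true _ = tt

  2≰⟦⟧ : ∀ b → ¬ (2 ≤ ⟦ b ⟧)
  2≰⟦⟧ true (s≤s ())

  term≤∑ : ∀ {A : Set} {l : List A} {x} (f : A → ℕ) → x ∈ l → f x ≤ ∑ l f
  term≤∑ f (here refl) = m≤m+n _ _
  term≤∑ f (there x∈l) = ≤-trans (term≤∑ f x∈l) (m≤n+m _ _)

  two-terms≤∑ : ∀ n (f : Fin n → ℕ) {i j} → i ≢ j → f i + f j ≤ ∑ (allFin n) f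
  two-terms≤∑ (suc n) f {zero} {zero} i≢j = ⊥-elim (i≢j refl)
  two-terms≤∑ (suc n) f {zero} {suc j} _ = subst (f zero + f (suc j) ≤_) (sym (∑-allFin-suc n f))
    (+-monoʳ-≤ (f zero) (term≤∑ (f ∘ suc) (∈-allFin j)))
  two-terms≤∑ (suc n) f {suc i} {zero} _ = subst₂ _≤_ (+-comm (f zero) (f (suc i))) (sym (∑-allFin-suc n f))
    (+-monoʳ-≤ (f zero) (term≤∑ (f ∘ suc) (∈-allFin i)))
  two-terms≤∑ (suc n) f {suc i} {suc j} i≢j = subst (f (suc i) + f (suc j) ≤_) (sym (∑-allFin-suc n f))
    (≤-trans (two-terms≤∑ n (f ∘ suc) (i≢j ∘ cong suc)) (m≤n+m _ _))

  Enumerates : ∀ {a n} → (Fin a → Fin n) → (Fin n → Bool) → Set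
  Enumerates g p = ∀ x → fibre g x ≡ ⟦ p x ⟧

  module Enumeration {a n} {g : Fin a → Fin n} {p : Fin n → Bool} (enum : Enumerates g p) where

    weight-enum : ∀ {m} (φ : Vec (Fin n) m) → weight g φ ≡ ⟦ all (p ∘ lookup φ) (allFin m) ⟧
    weight-enum []      = refl
    weight-enum {suc m} (x ∷ φ) = begin
        fibre g x * weight g φ
      ≡⟨ cong₂ _*_ (enum x) (weight-enum φ) ⟩
        ⟦ p x ⟧ * ⟦ all (p ∘ lookup φ) (allFin m) ⟧
      ≡⟨ sym (⟦∧⟧ (p x) _) ⟩
        ⟦ p x ∧ all (p ∘ lookup φ) (allFin m) ⟧
      ≡⟨ cong ⟦_⟧ (sym (all-allFin-suc m (p ∘ lookup (x ∷ φ)))) ⟩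
        ⟦ all (p ∘ lookup (x ∷ φ)) (allFin (suc m)) ⟧ ∎

    reindex-enum : ∀ m (F : Vec (Fin n) m → ℕ) →
      ∑ (allVec (allFin n) m) (λ φ → ⟦ all (p ∘ lookup φ) (allFin m) ⟧ * F φ)
      ≡ ∑ (allVec (allFin a) m) (F ∘ Vec.map g)
    reindex-enum m F = trans (∑-cong (allVec (allFin n) m) (λ φ → cong (_* F φ) (sym (weight-enum φ))))
                             (reindex m g F)

    injective : Injective _≡_ _≡_ g
    injective {y} {y′} gy≡gy′ with y ≟ y′
    ... | yes y≡y′ = y≡y′
    ... | no  y≢y′ = ⊥-elim (2≰⟦⟧ (p (g y))
      (subst₂ (λ u v → u + v ≤ ⟦ p (g y) ⟧)
              (T⇒⟦⟧≡1 (==ᶠ-complete refl)) (T⇒⟦⟧≡1 (==ᶠ-complete (sym gy≡gy′)))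
        (subst (_ ≤_) (enum (g y)) (two-terms≤∑ a (λ z → ⟦ g z ==ᶠ g y ⟧) y≢y′))))

    member : ∀ t → T (p (g t))
    member t = ⟦⟧≥1⇒T (p (g t)) (subst (1 ≤_) (enum (g t))
      (subst (_≤ fibre g (g t)) (T⇒⟦⟧≡1 (==ᶠ-complete refl))
             (term≤∑ (λ y → ⟦ g y ==ᶠ g t ⟧) (∈-allFin t))))

    onto : ∀ x → T (p x) → ∃[ t ] g t ≡ x
    onto x px with anyFin-sound (∑⟦⟧>0⇒any (λ y → g y ==ᶠ x) (allFin a)
                                  (subst (0 <_) (sym (trans (enum x) (T⇒⟦⟧≡1 px))) (s≤s z≤n)))
    ... | t , gt==x = t , ==ᶠ-sound gt==x

  filter-enumerates : ∀ {n} (p : Fin n → Bool) → Enumerates (List.lookup (filterᵇ p (allFin n))) p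
  filter-enumerates {n} p x = begin
      ∑ (allFin (length L)) (λ t → ⟦ List.lookup L t ==ᶠ x ⟧)
    ≡⟨ ∑-lookup L (λ y → ⟦ y ==ᶠ x ⟧) ⟩
      ∑ L (λ y → ⟦ y ==ᶠ x ⟧)
    ≡⟨ ∑-filter p (allFin n) (λ y → ⟦ y ==ᶠ x ⟧) ⟩
      ∑ (allFin n) (λ y → if p y then ⟦ y ==ᶠ x ⟧ else 0)
    ≡⟨ ∑-cong (allFin n) (λ y → trans (guard (p y) (y ==ᶠ x))
                                      (cong (λ b → ⟦ b ⟧ * ⟦ p y ⟧) (==ᶠ-sym y x))) ⟩
      ∑ (allFin n) (λ y → ⟦ x ==ᶠ y ⟧ * ⟦ p y ⟧)
    ≡⟨ ∑-point n x (⟦_⟧ ∘ p) ⟩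
      ⟦ p x ⟧ ∎
    where
    L = filterᵇ p (allFin n)
    guard : ∀ b c → (if b then ⟦ c ⟧ else 0) ≡ ⟦ c ⟧ * ⟦ b ⟧
    guard true  true  = refl
    guard true  false = refl
    guard false true  = refl
    guard false false = refl

  bijection-enumerates : ∀ {a n} {g : Fin a → Fin n} → Injective _≡_ _≡_ g → (∀ x → ∃[ y ] g y ≡ x) →
                         Enumerates g (λ _ → true)
  bijection-enumerates {a} {g = g} inj surj x = begin
      ∑ (allFin a) (λ y → ⟦ g y ==ᶠ x ⟧)
    ≡⟨ ∑-cong (allFin a) (λ y → trans (cong ⟦_⟧ (hits y)) (sym (*-identityʳ _))) ⟩
      ∑ (allFin a) (λ y → ⟦ y₀ ==ᶠ y ⟧ * 1)
    ≡⟨ ∑-point a y₀ (λ _ → 1) ⟩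
      1 ∎
    where
    y₀ = proj₁ (surj x)
    hits : ∀ y → (g y ==ᶠ x) ≡ (y₀ ==ᶠ y)
    hits y = T-ext (λ t → ==ᶠ-complete (inj (trans (proj₂ (surj x)) (sym (==ᶠ-sound t)))))
                   (λ t → ==ᶠ-complete (trans (cong g (sym (==ᶠ-sound t))) (proj₂ (surj x))))

  autCount-∑ : ∀ {m} (J : Graph m) → autCount J ≡ ∑ (allVec (allFin m) m) (⟦_⟧ ∘ isIsoB J J)
  autCount-∑ {m} J = length-filter (isIsoB J J) (allVec (allFin m) m)

  iso-count : ∀ {m k} (J : Graph m) (K : Graph k) →
              ∑ (allVec (allFin k) m) (⟦_⟧ ∘ isIsoB J K) ≡ ⟦ isomorphicB J K ⟧ * autCount J
  iso-count {m} {k} J K with isomorphicB J K in eq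
  ... | false = ¬any⇒∑⟦⟧≡0 (isIsoB J K) (allVec (allFin k) m) eq
  ... | true  with satisfied (Any.any⁻ (isIsoB J K) (allVec (allFin k) m) (subst T (sym eq) tt))
  ...   | χ₀ , isoχ₀ = begin
      ∑ (allVec (allFin k) m) (⟦_⟧ ∘ isIsoB J K)
    ≡⟨ ∑-cong (allVec (allFin k) m)
              (λ χ → sym (trans (cong (_* ⟦ isIsoB J K χ ⟧) everywhere) (*-identityˡ _))) ⟩
      ∑ (allVec (allFin k) m) (λ χ → ⟦ all (λ _ → true) (allFin m) ⟧ * ⟦ isIsoB J K χ ⟧)
    ≡⟨ Enumeration.reindex-enum (bijection-enumerates injective surjective) m (⟦_⟧ ∘ isIsoB J K) ⟩
      ∑ (allVec (allFin m) m) (λ σ → ⟦ isIsoB J K (Vec.map (lookup χ₀) σ) ⟧)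
    ≡⟨ ∑-cong (allVec (allFin m) m) (cong ⟦_⟧ ∘ compose-iso J K iso₀) ⟩
      ∑ (allVec (allFin m) m) (⟦_⟧ ∘ isIsoB J J)
    ≡⟨ sym (trans (*-identityˡ _) (autCount-∑ J)) ⟩
      1 * autCount J ∎
    where
    iso₀ = isIso-sound J K χ₀ isoχ₀
    open IsIso iso₀
    everywhere : ⟦ all (λ _ → true) (allFin m) ⟧ ≡ 1
    everywhere = T⇒⟦⟧≡1 (allFin-complete {m} (λ _ → tt))

  ⟦⟧-redundant : ∀ a b x → (T b → T a) → x * ⟦ b ⟧ ≡ ⟦ a ⟧ * (x * ⟦ b ⟧)
  ⟦⟧-redundant a true  x b⇒a = sym (trans (cong (_* (x * 1)) (T⇒⟦⟧≡1 (b⇒a tt))) (*-identityˡ _))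
  ⟦⟧-redundant a false x _   = trans (*-zeroʳ x) (sym (trans (cong (⟦ a ⟧ *_) (*-zeroʳ x)) (*-zeroʳ ⟦ a ⟧)))

  image : ∀ {m k} → Vec (Fin k) m → Vec Bool k
  image {m} ψ = Vec.tabulate (λ j → any (λ i → lookup ψ i ==ᶠ j) (allFin m))

  lookup-image : ∀ {m k} (ψ : Vec (Fin k) m) j → lookup (image ψ) j ≡ any (λ i → lookup ψ i ==ᶠ j) (allFin m)
  lookup-image ψ = lookup∘tabulate _

  _==ˢ_ : ∀ {k} → Vec Bool k → Vec Bool k → Bool
  []      ==ˢ []      = true
  (a ∷ U) ==ˢ (b ∷ V) = (a ==ᵇ b) ∧ (U ==ˢ V)

  ==ˢ-sound : ∀ {k} (U V : Vec Bool k) → T (U ==ˢ V) → U ≡ V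
  ==ˢ-sound []      []      _ = refl
  ==ˢ-sound (a ∷ U) (b ∷ V) t =
    let a≡b , U≡V = split∧ (a ==ᵇ b) t in cong₂ _∷_ (==ᵇ-sound a≡b) (==ˢ-sound U V U≡V)

  ==ˢ-complete : ∀ {k} {U V : Vec Bool k} → U ≡ V → T (U ==ˢ V)
  ==ˢ-complete {U = []}    refl = tt
  ==ˢ-complete {U = a ∷ U} refl = join∧ (==ᵇ-complete refl) (==ˢ-complete {U = U} refl)

  ∑-unique-subset : ∀ {k} (V : Vec Bool k) → ∑ (allSubsets k) (λ U → ⟦ V ==ˢ U ⟧) ≡ 1
  ∑-unique-subset []               = refl
  ∑-unique-subset {suc k} (b ∷ V) = trans (∑-allSubsets-suc k (λ U → ⟦ (b ∷ V) ==ˢ U ⟧)) (first-entry b)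
    where
    S = allSubsets k
    first-entry : ∀ c → ∑ S (λ U → ⟦ (c ∷ V) ==ˢ (true ∷ U) ⟧) + ∑ S (λ U → ⟦ (c ∷ V) ==ˢ (false ∷ U) ⟧)
                        ≡ 1
    first-entry true  = cong₂ _+_ (∑-unique-subset V) (∑-0 S)
    first-entry false = cong₂ _+_ (∑-0 S) (∑-unique-subset V)

  -- Induced embeddings of J into H with image exactly U are the isomorphisms J ≅ H[U], composed with
  -- the listing g of U; so there are Aut(J) of them if J ≅ H[U] and none otherwise.
  module EmbeddingsOnto {m k} (J : Graph m) (H : Graph k) (U : Vec Bool k) where

    k′ : ℕ
    k′ = length (members U)

    g : Fin k′ → Fin k
    g = List.lookup (members U)

    HU : Graph k′
    HU = inducedOn H (members U)

    open Enumeration {g = g} (filter-enumerates (lookup U))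

    imageIsU withinU : ∀ {a} → Vec (Fin k) a → Bool
    imageIsU ψ = image ψ ==ˢ U
    withinU {a} ψ = all (lookup U ∘ lookup ψ) (allFin a)

    imageIsU⇒withinU : ∀ (ψ : Vec (Fin k) m) → T (imageIsU ψ) → T (withinU ψ)
    imageIsU⇒withinU ψ t = allFin-complete λ i →
      subst (λ V → T (lookup V (lookup ψ i))) (==ˢ-sound (image ψ) U t)
      (subst T (sym (lookup-image ψ (lookup ψ i))) (anyFin-complete i (==ᶠ-complete refl)))

    image-through : ∀ (χ : Vec (Fin k′) m) → imageIsU (Vec.map g χ) ≡ surjB χ
    image-through χ = T-ext
      (λ t → surjB-complete χ λ s →
        let i , gχi==gs = anyFin-sound (subst T (lookup-image gχ (g s))
                            (subst (λ V → T (lookup V (g s))) (sym (==ˢ-sound (image gχ) U t)) (member s)))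
        in i , injective (trans (sym (at i)) (==ᶠ-sound gχi==gs)))
      (λ t → ==ˢ-complete (trans (tabulate-cong (hit (surjB-sound χ t))) (tabulate∘lookup U)))
      where
      gχ = Vec.map g χ
      at : ∀ i → lookup gχ i ≡ g (lookup χ i)
      at i = lookup-map i g χ
      hit : Surjectiveᵛ χ → ∀ j → any (λ i → lookup gχ i ==ᶠ j) (allFin m) ≡ lookup U j
      hit onto-χ j = T-ext
        (λ t → let i , gχi==j = anyFin-sound t in
               subst (T ∘ lookup U) (trans (sym (at i)) (==ᶠ-sound gχi==j)) (member (lookup χ i)))
        (λ t → let s , gs≡j = onto j t ; i , χi≡s = onto-χ s in
               anyFin-complete i (==ᶠ-complete (trans (at i) (trans (cong g χi≡s) gs≡j))))

    embedding-through : ∀ (χ : Vec (Fin k′) m) →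
                        ⟦ embᵇ J H (Vec.map g χ) ⟧ * ⟦ imageIsU (Vec.map g χ) ⟧ ≡ ⟦ isIsoB J HU χ ⟧
    embedding-through χ = begin
        ⟦ embᵇ J H (Vec.map g χ) ⟧ * ⟦ imageIsU (Vec.map g χ) ⟧
      ≡⟨ cong₂ (λ a b → ⟦ a ⟧ * ⟦ b ⟧) (emb-induced J H (members U) injective χ) (image-through χ) ⟩
        ⟦ embᵇ J HU χ ⟧ * ⟦ surjB χ ⟧
      ≡⟨ sym (⟦∧⟧ (embᵇ J HU χ) (surjB χ)) ⟩
        ⟦ embᵇ J HU χ ∧ surjB χ ⟧
      ≡⟨ cong ⟦_⟧ (sym (iso≡emb∧surj J HU χ)) ⟩
        ⟦ isIsoB J HU χ ⟧ ∎

    count : ∑ (allVec (allFin k) m) (λ ψ → ⟦ embᵇ J H ψ ⟧ * ⟦ imageIsU ψ ⟧) ≡ ⟦ isomorphicB J HU ⟧ * autCount J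
    count = begin
        ∑ (allVec (allFin k) m) (λ ψ → ⟦ embᵇ J H ψ ⟧ * ⟦ imageIsU ψ ⟧)
      ≡⟨ ∑-cong (allVec (allFin k) m)
                (λ ψ → ⟦⟧-redundant (withinU ψ) (imageIsU ψ) ⟦ embᵇ J H ψ ⟧ (imageIsU⇒withinU ψ)) ⟩
        ∑ (allVec (allFin k) m) (λ ψ → ⟦ withinU ψ ⟧ * (⟦ embᵇ J H ψ ⟧ * ⟦ imageIsU ψ ⟧))
      ≡⟨ reindex-enum m (λ ψ → ⟦ embᵇ J H ψ ⟧ * ⟦ imageIsU ψ ⟧) ⟩
        ∑ (allVec (allFin k′) m) (λ χ → ⟦ embᵇ J H (Vec.map g χ) ⟧ * ⟦ imageIsU (Vec.map g χ) ⟧)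
      ≡⟨ ∑-cong (allVec (allFin k′) m) embedding-through ⟩
        ∑ (allVec (allFin k′) m) (⟦_⟧ ∘ isIsoB J HU)
      ≡⟨ iso-count J HU ⟩
        ⟦ isomorphicB J HU ⟧ * autCount J ∎

  -- Counting induced embeddings by their image: #emb(J, H) = Aut(J) · s(J, H).
  embedding-count : ∀ {m k} (J : Graph m) (H : Graph k) →
                    ∑ (allVec (allFin k) m) (⟦_⟧ ∘ embᵇ J H) ≡ autCount J * sCount J H
  embedding-count {m} {k} J H = begin
      ∑ Ψ (⟦_⟧ ∘ embᵇ J H)
    ≡⟨ ∑-cong Ψ (λ ψ → sym (trans (cong (⟦ embᵇ J H ψ ⟧ *_) (∑-unique-subset (image ψ)))
                                  (*-identityʳ _))) ⟩
      ∑ Ψ (λ ψ → ⟦ embᵇ J H ψ ⟧ * ∑ 𝒰 (λ U → ⟦ image ψ ==ˢ U ⟧))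
    ≡⟨ ∑-cong Ψ (λ ψ → ∑-*ˡ 𝒰 ⟦ embᵇ J H ψ ⟧ (λ U → ⟦ image ψ ==ˢ U ⟧)) ⟩
      ∑ Ψ (λ ψ → ∑ 𝒰 (λ U → ⟦ embᵇ J H ψ ⟧ * ⟦ image ψ ==ˢ U ⟧))
    ≡⟨ ∑-swap Ψ 𝒰 (λ ψ U → ⟦ embᵇ J H ψ ⟧ * ⟦ image ψ ==ˢ U ⟧) ⟩
      ∑ 𝒰 (λ U → ∑ Ψ (λ ψ → ⟦ embᵇ J H ψ ⟧ * ⟦ image ψ ==ˢ U ⟧))
    ≡⟨ ∑-cong 𝒰 (EmbeddingsOnto.count J H) ⟩
      ∑ 𝒰 (λ U → ⟦ isJ U ⟧ * autCount J)
    ≡⟨ sym (∑-*ʳ 𝒰 (autCount J) (⟦_⟧ ∘ isJ)) ⟩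
      ∑ 𝒰 (⟦_⟧ ∘ isJ) * autCount J
    ≡⟨ cong (_* autCount J) (sym (length-filter isJ 𝒰)) ⟩
      sCount J H * autCount J
    ≡⟨ *-comm (sCount J H) (autCount J) ⟩
      autCount J * sCount J H ∎
    where
    Ψ = allVec (allFin k) m
    𝒰 = allSubsets k
    isJ : Vec Bool k → Bool
    isJ U = isomorphicB J (inducedOn H (members U))

  neighbourhood-count : ∀ {m n} (J : Graph m) (G : Graph n) (w : Fin n) →
    ∑ (allVec (allFin n) m) (λ φ → ⟦ all (adj G w ∘ lookup φ) (allFin m) ⟧ * ⟦ embᵇ J G φ ⟧)
    ≡ autCount J * sCount J (nbhdGraph G w)
  neighbourhood-count {m} {n} J G w = begin
      ∑ (allVec (allFin n) m) (λ φ → ⟦ all (adj G w ∘ lookup φ) (allFin m) ⟧ * ⟦ embᵇ J G φ ⟧)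
    ≡⟨ reindex-enum m (⟦_⟧ ∘ embᵇ J G) ⟩
      ∑ (allVec (allFin (length N)) m) (λ ψ → ⟦ embᵇ J G (Vec.map g ψ) ⟧)
    ≡⟨ ∑-cong (allVec (allFin (length N)) m) (cong ⟦_⟧ ∘ emb-induced J G N injective) ⟩
      ∑ (allVec (allFin (length N)) m) (⟦_⟧ ∘ embᵇ J (nbhdGraph G w))
    ≡⟨ embedding-count J (nbhdGraph G w) ⟩
      autCount J * sCount J (nbhdGraph G w) ∎
    where
    N = filterᵇ (adj G w) (allFin n)
    g = List.lookup N
    open Enumeration {g = g} (filter-enumerates (adj G w))

module Expansion where

  open import Data.Nat using (_^_)
  open import Data.Integer using (ℤ; +_; -_; _+_; _*_)
  open import Data.Integer.Tactic.RingSolver using (solve-∀)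
  open import Algebra.Properties.CommutativeSemigroup ℕₚ.*-commutativeSemigroup using (interchange)
  open import Data.List.Properties using (length-tabulate)
  open import Data.Vec using (toList)
  open FiniteSums ℤₚ.+-*-commutativeSemiring
  open Counting using (⟦_⟧)
  open ≡-Reasoning

  ∏ : ∀ {A : Set} → List A → (A → ℤ) → ℤ
  ∏ l f = prodℤ (map f l)

  ∏-map : ∀ {A B : Set} (g : A → B) (l : List A) (f : B → ℤ) → ∏ (map g l) f ≡ ∏ l (f ∘ g)
  ∏-map g l f = cong prodℤ (sym (map-∘ l))

  sgn : Bool → ℤ
  sgn true  = - + 1
  sgn false = + 1

  sign-product : ∀ {A : Set} (q : A → Bool) (x : A → ℤ) (S : List A) →
                 signℤ (length (filterᵇ q S)) * ∏ S x ≡ ∏ S (λ e → sgn (q e) * x e)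
  sign-product q x []      = refl
  sign-product q x (e ∷ S) with q e
  ... | true  = trans (move (signℤ (length (filterᵇ q S))) (x e) (∏ S x))
                      (cong ((- + 1 * x e) *_) (sign-product q x S))
    where
    move : ∀ s a P → - s * (a * P) ≡ (- + 1 * a) * (s * P)
    move = solve-∀
  ... | false = trans (move (signℤ (length (filterᵇ q S))) (x e) (∏ S x)) (cong ((+ 1 * x e) *_) (sign-product q x S))
    where
    move : ∀ s a P → s * (a * P) ≡ (+ 1 * a) * (s * P)
    move = solve-∀

  selection : ∀ {A : Set} (ps : List A) → Vec Bool (length ps) → List A
  selection ps E = map proj₁ (filterᵇ proj₂ (List.zip ps (toList E)))

  binomial-step : ∀ a P → a * P + P ≡ (+ 1 + a) * P
  binomial-step = solve-∀

  expand-selections : ∀ {A : Set} (z : A → ℤ) (ps : List A) →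
                      ∑ (allSubsets (length ps)) (λ E → ∏ (selection ps E) z) ≡ ∏ ps (λ p → + 1 + z p)
  expand-selections z []       = refl
  expand-selections z (p ∷ ps) = begin
      ∑ (allSubsets (suc (length ps))) (λ E → ∏ (selection (p ∷ ps) E) z)
    ≡⟨ ∑-allSubsets-suc (length ps) _ ⟩
      ∑ 𝒮 (λ E → z p * ∏ (selection ps E) z) + ∑ 𝒮 (λ E → ∏ (selection ps E) z)
    ≡⟨ cong (_+ ∑ 𝒮 (λ E → ∏ (selection ps E) z)) (sym (∑-*ˡ 𝒮 (z p) _)) ⟩
      z p * ∑ 𝒮 (λ E → ∏ (selection ps E) z) + ∑ 𝒮 (λ E → ∏ (selection ps E) z)
    ≡⟨ cong (λ P → z p * P + P) (expand-selections z ps) ⟩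
      z p * ∏ ps (λ q → + 1 + z q) + ∏ ps (λ q → + 1 + z q)
    ≡⟨ binomial-step (z p) _ ⟩
      ∏ (p ∷ ps) (λ q → + 1 + z q) ∎
    where 𝒮 = allSubsets (length ps)

  members-suc : ∀ {m} b (V : Vec Bool m) → filterᵇ (lookup (b ∷ V)) (tabulate suc) ≡ map suc (members V)
  members-suc {m} b V = trans (cong (filterᵇ (lookup (b ∷ V))) (sym (map-tabulate id suc))) (filter-map (allFin m))
    where
    filter-map : ∀ (l : List (Fin m)) → filterᵇ (lookup (b ∷ V)) (map suc l) ≡ map suc (filterᵇ (lookup V) l)
    filter-map []      = refl
    filter-map (i ∷ l) with lookup V i
    ... | true  = cong (suc i ∷_) (filter-map l)
    ... | false = filter-map l

  expand-members : ∀ m (z : Fin m → ℤ) →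
                   ∑ (allSubsets m) (λ V → ∏ (members V) z) ≡ ∏ (allFin m) (λ u → + 1 + z u)
  expand-members zero    z = refl
  expand-members (suc m) z = begin
      ∑ (allSubsets (suc m)) (λ V → ∏ (members V) z)
    ≡⟨ ∑-allSubsets-suc m _ ⟩
      ∑ 𝒮 (λ V → z zero * ∏ (filterᵇ (lookup (true ∷ V)) (tabulate suc)) z)
        + ∑ 𝒮 (λ V → ∏ (filterᵇ (lookup (false ∷ V)) (tabulate suc)) z)
    ≡⟨ cong₂ _+_ (trans (∑-cong 𝒮 (λ V → cong (z zero *_) (tail true V))) (sym (∑-*ˡ 𝒮 (z zero) _)))
                 (∑-cong 𝒮 (tail false)) ⟩
      z zero * ∑ 𝒮 (λ V → ∏ (members V) (z ∘ suc)) + ∑ 𝒮 (λ V → ∏ (members V) (z ∘ suc))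
    ≡⟨ cong (λ P → z zero * P + P) (expand-members m (z ∘ suc)) ⟩
      z zero * ∏ (allFin m) (λ u → + 1 + z (suc u)) + ∏ (allFin m) (λ u → + 1 + z (suc u))
    ≡⟨ binomial-step (z zero) _ ⟩
      (+ 1 + z zero) * ∏ (allFin m) (λ u → + 1 + z (suc u))
    ≡⟨ cong ((+ 1 + z zero) *_) (sym (∏-map suc (allFin m) (λ u → + 1 + z u))) ⟩
      (+ 1 + z zero) * ∏ (map suc (allFin m)) (λ u → + 1 + z u)
    ≡⟨ cong (λ l → (+ 1 + z zero) * ∏ l (λ u → + 1 + z u)) (map-tabulate id suc) ⟩
      ∏ (allFin (suc m)) (λ u → + 1 + z u) ∎
    where
    𝒮 = allSubsets m
    tail : ∀ b V → ∏ (filterᵇ (lookup (b ∷ V)) (tabulate suc)) z ≡ ∏ (members V) (z ∘ suc)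
    tail b V = trans (cong (λ l → ∏ l z) (members-suc b V)) (∏-map suc (members V) z)

  ∏-two-or-zero : ∀ {A : Set} (q : A → Bool) (l : List A) →
                  ∏ l (λ a → if q a then + 2 else + 0) ≡ + (2 ^ length l ℕ.* ⟦ all q l ⟧)
  ∏-two-or-zero q []      = refl
  ∏-two-or-zero q (a ∷ l) with q a
  ... | true  = trans (cong (+ 2 *_) (∏-two-or-zero q l))
                      (trans (sym (ℤₚ.pos-* 2 (2 ^ length l ℕ.* ⟦ all q l ⟧)))
                             (cong +_ (sym (ℕₚ.*-assoc 2 (2 ^ length l) ⟦ all q l ⟧))))
  ... | false = cong +_ (sym (ℕₚ.*-zeroʳ (2 ^ suc (length l))))

  pair-factor : ∀ b c → + 1 + sgn (not b) * (if c then + 1 else - + 1) ≡ (if b ==ᵇ c then + 2 else + 0)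
  pair-factor true  true  = refl
  pair-factor true  false = refl
  pair-factor false true  = refl
  pair-factor false false = refl

  vertex-factor : ∀ {n} (G : Graph n) (w u : Fin n) → + 1 + xG G u w ≡ (if adj G w u then + 2 else + 0)
  vertex-factor G w u = trans (cong (λ b → + 1 + (if b then + 1 else - + 1)) (Graph.sym G u w)) (by-cases (adj G w u))
    where
    by-cases : ∀ c → + 1 + (if c then + 1 else - + 1) ≡ (if c then + 2 else + 0)
    by-cases true  = refl
    by-cases false = refl

  ∑-pos : ∀ {A : Set} (l : List A) (f : A → ℕ) → ∑ l (λ x → + f x) ≡ + ℕΣ.∑ l f
  ∑-pos []      f = refl
  ∑-pos (x ∷ l) f = trans (cong (λ t → + f x + t) (∑-pos l f)) (sym (ℤₚ.pos-+ (f x) (ℕΣ.∑ l f)))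

  module Numerator {m n} (J : Graph m) (G : Graph n) (w : Fin n) where

    P : ℕ
    P = length (pairs m)

    nonEdge : Fin m × Fin m → Bool
    nonEdge e = not (adj J (proj₁ e) (proj₂ e))

    xφ : Vec (Fin n) m → Fin m × Fin m → ℤ
    xφ φ e = xG G (lookup φ (proj₁ e)) (lookup φ (proj₂ e))

    yφ : Vec (Fin n) m → Fin m → ℤ
    yφ φ u = xG G (lookup φ u) w

    agrees : Vec (Fin n) m → Fin m × Fin m → Bool
    agrees φ e = adj J (proj₁ e) (proj₂ e) ==ᵇ adj G (lookup φ (proj₁ e)) (lookup φ (proj₂ e))

    signE : Vec Bool P → ℤ
    signE E = signℤ (length (filterᵇ nonEdge (selectedPairs E)))

    -- The numerator of r̃(J, V(G) ∖ {w}) at the evaluation point; rTildeEval J G w is by definition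
    -- divℚ numerator (2^(P+m) · Aut(J)).
    numerator : ℤ
    numerator = ∑ (allSubsets m) (λ V → ∑ (allSubsets P) (λ E → signE E * kTildeEval (selectedPairs E) V G w))

    edgeSum vertexSum : Vec (Fin n) m → ℤ
    edgeSum   φ = ∑ (allSubsets P) (λ E → signE E * ∏ (selectedPairs E) (xφ φ))
    vertexSum φ = ∑ (allSubsets m) (λ V → ∏ (members V) (yφ φ))

    factorise : numerator ≡ ∑ (injAvoiding m w) (λ φ → edgeSum φ * vertexSum φ)
    factorise = begin
        numerator
      ≡⟨ ∑-cong 𝒱 (λ V → ∑-cong ℰ (λ E → ∑-*ˡ I (signE E) (λ φ → X E φ * Y V φ))) ⟩
        ∑ 𝒱 (λ V → ∑ ℰ (λ E → ∑ I (λ φ → signE E * (X E φ * Y V φ))))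
      ≡⟨ ∑-cong 𝒱 (λ V → ∑-swap ℰ I (λ E φ → signE E * (X E φ * Y V φ))) ⟩
        ∑ 𝒱 (λ V → ∑ I (λ φ → ∑ ℰ (λ E → signE E * (X E φ * Y V φ))))
      ≡⟨ ∑-cong 𝒱 (λ V → ∑-cong I (λ φ → pull-out V φ)) ⟩
        ∑ 𝒱 (λ V → ∑ I (λ φ → edgeSum φ * Y V φ))
      ≡⟨ ∑-swap 𝒱 I (λ V φ → edgeSum φ * Y V φ) ⟩
        ∑ I (λ φ → ∑ 𝒱 (λ V → edgeSum φ * Y V φ))
      ≡⟨ ∑-cong I (λ φ → sym (∑-*ˡ 𝒱 (edgeSum φ) (λ V → Y V φ))) ⟩
        ∑ I (λ φ → edgeSum φ * vertexSum φ) ∎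
      where
      𝒱 = allSubsets m
      ℰ = allSubsets P
      I = injAvoiding m w
      X : Vec Bool P → Vec (Fin n) m → ℤ
      X E φ = ∏ (selectedPairs E) (xφ φ)
      Y : Vec Bool m → Vec (Fin n) m → ℤ
      Y V φ = ∏ (members V) (yφ φ)
      pull-out : ∀ V φ → ∑ ℰ (λ E → signE E * (X E φ * Y V φ)) ≡ edgeSum φ * Y V φ
      pull-out V φ = trans (∑-cong ℰ (λ E → sym (ℤₚ.*-assoc (signE E) (X E φ) (Y V φ))))
                           (sym (∑-*ʳ ℰ (Y V φ) (λ E → signE E * X E φ)))

    -- ∑_E (-1)^{|E ∖ E(J)|} ∏_{e ∈ E} x^G_{φ(e)} = ∏_e (1 ± x^G_{φ(e)}) = 2^P · [φ preserves (non-)adjacency].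
    edgeSum-value : ∀ φ → edgeSum φ ≡ + (2 ^ P ℕ.* ⟦ sameAdjᵇ J G φ ⟧)
    edgeSum-value φ = begin
        edgeSum φ
      ≡⟨ ∑-cong (allSubsets P) (λ E → sign-product nonEdge (xφ φ) (selectedPairs E)) ⟩
        ∑ (allSubsets P) (λ E → ∏ (selectedPairs E) (λ e → sgn (nonEdge e) * xφ φ e))
      ≡⟨ expand-selections (λ e → sgn (nonEdge e) * xφ φ e) (pairs m) ⟩
        ∏ (pairs m) (λ e → + 1 + sgn (nonEdge e) * xφ φ e)
      ≡⟨ cong prodℤ (map-cong (λ e → pair-factor _ _) (pairs m)) ⟩
        ∏ (pairs m) (λ e → if agrees φ e then + 2 else + 0)
      ≡⟨ ∏-two-or-zero (agrees φ) (pairs m) ⟩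
        + (2 ^ P ℕ.* ⟦ sameAdjᵇ J G φ ⟧) ∎

    -- ∑_V ∏_{u ∈ V} x^G_{φ(u)w} = ∏_u (1 + x^G_{φ(u)w}) = 2^m · [every φ(u) is adjacent to w].
    vertexSum-value : ∀ φ → vertexSum φ ≡ + (2 ^ m ℕ.* ⟦ all (adj G w ∘ lookup φ) (allFin m) ⟧)
    vertexSum-value φ = begin
        vertexSum φ
      ≡⟨ expand-members m (yφ φ) ⟩
        ∏ (allFin m) (λ u → + 1 + yφ φ u)
      ≡⟨ cong prodℤ (map-cong (λ u → vertex-factor G w (lookup φ u)) (allFin m)) ⟩
        ∏ (allFin m) (λ u → if adj G w (lookup φ u) then + 2 else + 0)
      ≡⟨ ∏-two-or-zero (adj G w ∘ lookup φ) (allFin m) ⟩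
        + (2 ^ length (allFin m) ℕ.* ⟦ all (adj G w ∘ lookup φ) (allFin m) ⟧)
      ≡⟨ cong (λ k → + (2 ^ k ℕ.* ⟦ all (adj G w ∘ lookup φ) (allFin m) ⟧)) (length-tabulate {n = m} id) ⟩
        + (2 ^ m ℕ.* ⟦ all (adj G w ∘ lookup φ) (allFin m) ⟧) ∎

    avoids inN : Vec (Fin n) m → Bool
    avoids φ = all (λ i → not (lookup φ i ==ᶠ w)) (allFin m)
    inN    φ = all (adj G w ∘ lookup φ) (allFin m)

    embeddings : ℕ
    embeddings = ℕΣ.∑ (allVec (allFin n) m) (λ φ → ⟦ inN φ ⟧ ℕ.* ⟦ embᵇ J G φ ⟧)

    -- G is loopless, so maps into N(w) avoid w.
    inN⇒avoids : ∀ φ → T (inN φ) → T (avoids φ)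
    inN⇒avoids φ t = allFin-complete {m} λ i → Equivalence.from T-not-≡ (==ᶠ-false λ φi≡w →
      subst T (irrefl G w) (subst (T ∘ adj G w) φi≡w (allFin-sound {m} {adj G w ∘ lookup φ} t i)))

    -- Only injective φ into N(w) preserving (non-)adjacency contribute, each with weight 2^(P+m).
    guarded : ∀ K c₁ c₂ s a → (T a → T c₂) →
              (if c₁ ∧ c₂ then + (K ℕ.* (⟦ s ⟧ ℕ.* ⟦ a ⟧)) else + 0)
              ≡ + (K ℕ.* (⟦ a ⟧ ℕ.* ⟦ c₁ ∧ s ⟧))
    guarded K false c₂    s a     _ = cong +_ (sym (trans (cong (K ℕ.*_) (ℕₚ.*-zeroʳ ⟦ a ⟧)) (ℕₚ.*-zeroʳ K)))
    guarded K true  true  s a     _ = cong (λ t → + (K ℕ.* t)) (ℕₚ.*-comm ⟦ s ⟧ ⟦ a ⟧)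
    guarded K true  false s false _ = cong +_ (sym (ℕₚ.*-zeroʳ K))
    guarded K true  false s true  a⇒c₂ = ⊥-elim (a⇒c₂ tt)

    numerator-value : numerator ≡ + (2 ^ (P ℕ.+ m) ℕ.* embeddings)
    numerator-value = begin
        numerator
      ≡⟨ factorise ⟩
        ∑ (injAvoiding m w) (λ φ → edgeSum φ * vertexSum φ)
      ≡⟨ ∑-filter (λ φ → injB φ ∧ avoids φ) Φ (λ φ → edgeSum φ * vertexSum φ) ⟩
        ∑ Φ (λ φ → if injB φ ∧ avoids φ then edgeSum φ * vertexSum φ else + 0)
      ≡⟨ ∑-cong Φ term ⟩
        ∑ Φ (λ φ → + (K ℕ.* (⟦ inN φ ⟧ ℕ.* ⟦ embᵇ J G φ ⟧)))
      ≡⟨ ∑-pos Φ (λ φ → K ℕ.* (⟦ inN φ ⟧ ℕ.* ⟦ embᵇ J G φ ⟧)) ⟩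
        + ℕΣ.∑ Φ (λ φ → K ℕ.* (⟦ inN φ ⟧ ℕ.* ⟦ embᵇ J G φ ⟧))
      ≡⟨ cong +_ (sym (ℕΣ.∑-*ˡ Φ K (λ φ → ⟦ inN φ ⟧ ℕ.* ⟦ embᵇ J G φ ⟧))) ⟩
        + (K ℕ.* ℕΣ.∑ Φ (λ φ → ⟦ inN φ ⟧ ℕ.* ⟦ embᵇ J G φ ⟧)) ∎
      where
      Φ = allVec (allFin n) m
      K = 2 ^ (P ℕ.+ m)
      powers : ∀ s a → + (2 ^ P ℕ.* s) * + (2 ^ m ℕ.* a) ≡ + (K ℕ.* (s ℕ.* a))
      powers s a = trans (sym (ℤₚ.pos-* (2 ^ P ℕ.* s) (2 ^ m ℕ.* a)))
        (cong +_ (trans (interchange (2 ^ P) s (2 ^ m) a)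
                        (cong (ℕ._* (s ℕ.* a)) (sym (ℕₚ.^-distribˡ-+-* 2 P m)))))
      term : ∀ φ → (if injB φ ∧ avoids φ then edgeSum φ * vertexSum φ else + 0)
                   ≡ + (K ℕ.* (⟦ inN φ ⟧ ℕ.* ⟦ embᵇ J G φ ⟧))
      term φ = trans (cong (λ t → if injB φ ∧ avoids φ then t else + 0)
                           (trans (cong₂ _*_ (edgeSum-value φ) (vertexSum-value φ)) (powers _ _)))
                     (guarded K (injB φ) (avoids φ) (sameAdjᵇ J G φ) (inN φ) (inN⇒avoids φ))

-- Cancelling a positive factor: (d · s) / d = s / 1, since both normalise the same unnormalised fraction.
divℚ-cancel : ∀ d s → 0 < d → divℚ (+ (d ℕ.* s)) d ≡ + s / 1
divℚ-cancel (suc d) s _ = ℚₚ.fromℚᵘ-cong {mkℚᵘ (+ (suc d ℕ.* s)) d} {mkℚᵘ (+ s) 0} (*≡* (begin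
    + (suc d ℕ.* s) ℤ.* + 1 ≡⟨ ℤₚ.*-identityʳ _ ⟩
    + (suc d ℕ.* s)         ≡⟨ cong +_ (ℕₚ.*-comm (suc d) s) ⟩
    + (s ℕ.* suc d)         ≡⟨ ℤₚ.pos-* s (suc d) ⟩
    + s ℤ.* + suc d         ∎))
  where open ≡-Reasoning

mainTheorem8 : ∀ {m n : ℕ} (J : Graph m) (G : Graph n) (w : Fin n) →
    (+ sCount J (nbhdGraph G w)) / 1 ≡ rTildeEval J G w
mainTheorem8 {m} {n} J G w = sym (begin
    rTildeEval J G w
  ≡⟨ cong (λ z → divℚ z D) numerator-value ⟩
    divℚ (+ (K ℕ.* embeddings)) D
  ≡⟨ cong (λ e → divℚ (+ (K ℕ.* e)) D) (Counting.neighbourhood-count J G w) ⟩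
    divℚ (+ (K ℕ.* (autCount J ℕ.* s))) D
  ≡⟨ cong (λ t → divℚ (+ t) D) (sym (ℕₚ.*-assoc K (autCount J) s)) ⟩
    divℚ (+ (D ℕ.* s)) D
  ≡⟨ divℚ-cancel D s (ℕₚ.*-mono-< (ℕₚ.m^n>0 2 (P ℕ.+ m)) (autCount-pos J)) ⟩
    + s / 1 ∎)
  where
  open ≡-Reasoning
  open Expansion.Numerator J G w
  K = 2 ℕ.^ (P ℕ.+ m)
  D = K ℕ.* autCount J
  s = sCount J (nbhdGraph G w)
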